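{- Let $\langle\mathbf{A}_{\mathrm d},\mathbf{A},\iota\rangle$ be a (generalized) additive quantale with multiplication, let $\mathbf{P}$ and $\mathbf{Q}$ be projective $\mathbf{A}$-modules, and let $\gamma$ and $\delta$ be structural nuclei on $\mathbf{P}$ and $\mathbf{Q}$ respectively. Then $\mathbf{P}_\gamma$ and $\mathbf{Q}_\delta$ are isomorphic $\mathbf{A}$-modules if and only if there are module homomorphisms $\tau\colon\mathbf{P}\to\mathbf{Q}$ and $\rho\colon\mathbf{Q}\to\mathbf{P}$ such that for all $\Gamma,\Delta\in P$ and $E,F\in Q$: (1) $\Gamma\vdash_\gamma\Delta\iff\tau(\Gamma)\vdash_\delta\tau(\Delta)$, and $E\vdash_\delta(\tau\circ\rho)(E)\vdash_\delta E$; (2) $E\vdash_\delta F\iff\rho(E)\vdash_\gamma\rho(F)$, and $\Gamma\vdash_\gamma(\rho\circ\tau)(\Gamma)\vdash_\gamma\Gamma$. Moreover, module homomorphisms $\tau,\rho$ satisfy the conditions in (1) (for all $\Gamma,\Delta,E$) if and only if they satisfy the conditions in (2) (for all $E,F,\Gamma$).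
   Context: Fix one of two parallel settings: plain ("joins" = joins of arbitrary families) or generalized ("joins" = joins of non-empty families). A (generalized) quantale is $\langle Q,\bigvee,+,\mathsf{0}\rangle$ with $Q$ a poset having all such joins, $\langle Q,+,\mathsf{0}\rangle$ a monoid with $+$ order-preserving and distributing over such joins on both sides. A (generalized) additive quantale with multiplication is a triple $\langle\mathbf{A}_{\mathrm d},\mathbf{A},\iota\rangle$: $\mathbf{A}_{\mathrm d}$ a monoid, $\mathbf{A}$ a (generalized) quantale with an additional monoid structure $\langle A,\cdot,\mathsf 1\rangle$, $\iota$ a monoid homomorphism, such that $(\bigvee_i a_i)\cdot b=\bigvee_i(a_i\cdot b)$, $(a+b)\cdot c=a\cdot c+b\cdot c$, $\mathsf0\cdot a=\mathsf0$, and for $d\in\mathbf{A}_{\mathrm d}$ left multiplication by $\iota(d)$ preserves joins, $+$, $\mathsf0$. An $\mathbf{A}$-module is a (generalized) quantale $\mathbf{Q}$ with $\ast\colon A\times Q\to Q$, order-preserving in both coordinates, with $(a\cdot b)\ast x=a\ast(b\ast x)$, $\mathsf1\ast x=x$, $(a+b)\ast x=a\ast x+b\ast x$, $\mathsf0\ast x=\mathsf0$, $(\bigvee_i a_i)\ast x=\bigvee_i(a_i\ast x)$, and $x\mapsto\iota(d)\ast x$ preserving $+$, $\mathsf0$, joins for $d\in\mathbf{A}_{\mathrm d}$; module homomorphisms are quantale homomorphisms $f$ with $f(a\ast x)=a\ast f(x)$. A module $\mathbf{P}$ is projective if for every surjective module homomorphism $g\colon\mathbf{R}\to\mathbf{S}$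 and module homomorphism $h\colon\mathbf{P}\to\mathbf{S}$ there is a module homomorphism $h'\colon\mathbf{P}\to\mathbf{R}$ with $g\circ h'=h$. A structural nucleus on a module $\mathbf{Q}$ is an order-preserving, expansive, idempotent map $\gamma$ with $\gamma(x)+\gamma(y)\le\gamma(x+y)$ and $a\ast\gamma(x)\le\gamma(a\ast x)$ for all $a$; $\mathbf{Q}_\gamma$ is the module on $\gamma[Q]$ with $\bigvee_\gamma X=\gamma(\bigvee X)$, $x+_\gamma y=\gamma(x+y)$, $\mathsf0_\gamma=\gamma(\mathsf0)$, $a\ast_\gamma x=\gamma(a\ast x)$. For a nucleus $\gamma$, the relation $\vdash_\gamma$ is defined by $x\vdash_\gamma y\iff y\leq\gamma(x)$; chains $x\vdash y\vdash z$ abbreviate $x\vdash y$ and $y\vdash z$. -}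

module Defs where

open import Level using (Level; _⊔_; Setω) renaming (suc to lsuc)
open import Data.Unit.Polymorphic using (⊤)
open import Data.Product using (Σ; _×_; _,_; proj₁; proj₂)
open import Relation.Binary.PropositionalEquality using (_≡_)
open import Relation.Binary.Structures using (IsPartialOrder)
open import Relation.Binary.Core using (_Preserves₂_⟶_⟶_)
open import Algebra.Structures using (IsMonoid)
open import Function.Bundles using (_⇔_)

-- The two parallel settings.
-- plain       : joins of arbitrary families
-- generalized : joins of non-empty (inhabited) families
-- Families are indexed by types  I : Set ι  for a fixed index level ι.

data Setting : Set where
  plain generalized : Setting

Allowed : Setting → ∀ {ι} → Set ι → Set ι
Allowed plain       I = ⊤
Allowed generalized I = I

IsJoin : ∀ {c ℓ ι} {C : Set c} (_≤_ : C → C → Set ℓ) {I : Set ι}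
         → (I → C) → C → Set (c ⊔ ℓ ⊔ ι)
IsJoin {C = C} _≤_ {I} x s = (∀ i → x i ≤ s) × (∀ u → (∀ i → x i ≤ u) → s ≤ u)

record QuantaleOps (s : Setting) (ι c ℓ : Level) : Set (lsuc (ι ⊔ c ⊔ ℓ)) where
  field
    Carrier : Set c
    _≤_     : Carrier → Carrier → Set ℓ
    ⋁       : {I : Set ι} → (I → Carrier) → Allowed s I → Carrier
    _+_     : Carrier → Carrier → Carrier
    𝟘       : Carrier

record IsQuantale {s ι c ℓ} (Q : QuantaleOps s ι c ℓ) : Set (lsuc ι ⊔ c ⊔ ℓ) where
  open QuantaleOps Q
  field
    isPartialOrder : IsPartialOrder _≡_ _≤_
    ⋁-isJoin       : ∀ {I : Set ι} (x : I → Carrier) (w : Allowed s I) → IsJoin _≤_ x (⋁ x w)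
    +-isMonoid     : IsMonoid _≡_ _+_ 𝟘
    +-mono         : _+_ Preserves₂ _≤_ ⟶ _≤_ ⟶ _≤_
    +-distribʳ-⋁   : ∀ {I : Set ι} (x : I → Carrier) (w : Allowed s I) b
                     → (⋁ x w) + b ≡ ⋁ (λ i → x i + b) w
    +-distribˡ-⋁   : ∀ {I : Set ι} (x : I → Carrier) (w : Allowed s I) b
                     → b + (⋁ x w) ≡ ⋁ (λ i → b + x i) w

record AQM (s : Setting) (ι d a ℓ : Level) : Set (lsuc (ι ⊔ d ⊔ a ⊔ ℓ)) where
  field
    D          : Set d
    _∙_        : D → D → D
    ε          : D
    D-isMonoid : IsMonoid _≡_ _∙_ ε
    A          : QuantaleOps s ι a ℓ
    A-isQuantale : IsQuantale A
  open QuantaleOps A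
  field
    _·_        : Carrier → Carrier → Carrier
    𝟙          : Carrier
    ·-isMonoid : IsMonoid _≡_ _·_ 𝟙
    inj        : D → Carrier
    inj-∙      : ∀ d e → inj (d ∙ e) ≡ inj d · inj e
    inj-ε      : inj ε ≡ 𝟙
    ·-distribʳ-⋁ : ∀ {I : Set ι} (x : I → Carrier) (w : Allowed s I) b
                   → (⋁ x w) · b ≡ ⋁ (λ i → x i · b) w
    ·-distribʳ-+ : ∀ a b c → (a + b) · c ≡ (a · c) + (b · c)
    ·-zeroˡ      : ∀ a → 𝟘 · a ≡ 𝟘
    inj-⋁        : ∀ dd {I : Set ι} (x : I → Carrier) (w : Allowed s I)
                   → inj dd · (⋁ x w) ≡ ⋁ (λ i → inj dd · x i) w
    inj-+        : ∀ dd a b → inj dd · (a + b) ≡ (inj dd · a) + (inj dd · b)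
    inj-𝟘        : ∀ dd → inj dd · 𝟘 ≡ 𝟘

module _ {s ι d a aℓ} (𝔸 : AQM s ι d a aℓ) where
  private
    module 𝔸 = AQM 𝔸
    module A = QuantaleOps 𝔸.A

  record ModuleOps (c ℓ : Level) : Set (lsuc (ι ⊔ c ⊔ ℓ) ⊔ a) where
    field
      Q   : QuantaleOps s ι c ℓ
    open QuantaleOps Q public
    field
      _∗_ : A.Carrier → Carrier → Carrier

  record IsModule {c ℓ} (M : ModuleOps c ℓ) : Set (lsuc ι ⊔ a ⊔ aℓ ⊔ d ⊔ c ⊔ ℓ) where
    open ModuleOps M
    field
      Q-isQuantale : IsQuantale Q
      ∗-mono       : _∗_ Preserves₂ A._≤_ ⟶ _≤_ ⟶ _≤_
      ∗-assoc      : ∀ a b x → (a 𝔸.· b) ∗ x ≡ a ∗ (b ∗ x)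
      ∗-identity   : ∀ x → 𝔸.𝟙 ∗ x ≡ x
      ∗-distrib-+  : ∀ a b x → (a A.+ b) ∗ x ≡ (a ∗ x) + (b ∗ x)
      ∗-zero       : ∀ x → A.𝟘 ∗ x ≡ 𝟘
      ∗-distrib-⋁  : ∀ {I : Set ι} (as : I → A.Carrier) (w : Allowed s I) x
                     → (A.⋁ as w) ∗ x ≡ ⋁ (λ i → as i ∗ x) w
      inj-∗-+      : ∀ dd x y → 𝔸.inj dd ∗ (x + y) ≡ (𝔸.inj dd ∗ x) + (𝔸.inj dd ∗ y)
      inj-∗-𝟘      : ∀ dd → 𝔸.inj dd ∗ 𝟘 ≡ 𝟘
      inj-∗-⋁      : ∀ dd {I : Set ι} (x : I → Carrier) (w : Allowed s I)
                     → 𝔸.inj dd ∗ (⋁ x w) ≡ ⋁ (λ i → 𝔸.inj dd ∗ x i) w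

  record Module (c ℓ : Level) : Set (lsuc (ι ⊔ c ⊔ ℓ) ⊔ a ⊔ aℓ ⊔ d) where
    field
      ops      : ModuleOps c ℓ
      isModule : IsModule ops
    open ModuleOps ops public

  record Hom {c₁ ℓ₁ c₂ ℓ₂} (M : ModuleOps c₁ ℓ₁) (N : ModuleOps c₂ ℓ₂)
         : Set (lsuc ι ⊔ a ⊔ c₁ ⊔ c₂) where
    private
      module M = ModuleOps M
      module N = ModuleOps N
    field
      fun   : M.Carrier → N.Carrier
      pres-⋁ : ∀ {I : Set ι} (x : I → M.Carrier) (w : Allowed s I)
               → fun (M.⋁ x w) ≡ N.⋁ (λ i → fun (x i)) w
      pres-+ : ∀ x y → fun (x M.+ y) ≡ fun x N.+ fun y
      pres-𝟘 : fun M.𝟘 ≡ N.𝟘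
      pres-∗ : ∀ a x → fun (a M.∗ x) ≡ a N.∗ fun x

  record Iso {c₁ ℓ₁ c₂ ℓ₂} (M : ModuleOps c₁ ℓ₁) (N : ModuleOps c₂ ℓ₂)
         : Set (lsuc ι ⊔ a ⊔ c₁ ⊔ c₂) where
    field
      to      : Hom M N
      from    : Hom N M
      from∘to : ∀ x → Hom.fun from (Hom.fun to x) ≡ x
      to∘from : ∀ y → Hom.fun to (Hom.fun from y) ≡ y

  ProjectiveAt : ∀ {c ℓ} (c' ℓ' : Level) → Module c ℓ → Set (lsuc (ι ⊔ c' ⊔ ℓ') ⊔ a ⊔ aℓ ⊔ d ⊔ c)
  ProjectiveAt c' ℓ' P =
    (R S : Module c' ℓ') (g : Hom (Module.ops R) (Module.ops S))
    → (∀ y → Σ (Module.Carrier R) λ x → Hom.fun g x ≡ y)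
    → (h : Hom (Module.ops P) (Module.ops S))
    → Σ (Hom (Module.ops P) (Module.ops R)) λ h' → ∀ x → Hom.fun g (Hom.fun h' x) ≡ Hom.fun h x

  Projective : ∀ {c ℓ} → Module c ℓ → Setω
  Projective P = ∀ {c' ℓ'} → ProjectiveAt c' ℓ' P

  record StructuralNucleus {c ℓ} (M : Module c ℓ) : Set (a ⊔ c ⊔ ℓ) where
    open Module M
    field
      γ         : Carrier → Carrier
      mono      : ∀ {x y} → x ≤ y → γ x ≤ γ y
      expansive : ∀ x → x ≤ γ x
      idem      : ∀ x → γ (γ x) ≡ γ x
      +-sub     : ∀ x y → (γ x + γ y) ≤ γ (x + y)
      ∗-sub     : ∀ a x → (a ∗ γ x) ≤ γ (a ∗ x)

  -- the module Q_γ on γ[Q]  (γ[Q] represented as the fixed points of γ)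
  _/_ : ∀ {c ℓ} (M : Module c ℓ) → StructuralNucleus M → ModuleOps c ℓ
  M / N = record
    { Q = record
        { Carrier = Σ Carrier (λ x → γ x ≡ x)
        ; _≤_     = λ x y → proj₁ x ≤ proj₁ y
        ; ⋁       = λ x w → γ (⋁ (λ i → proj₁ (x i)) w) , idem _
        ; _+_     = λ x y → γ (proj₁ x + proj₁ y) , idem _
        ; 𝟘       = γ 𝟘 , idem _
        }
    ; _∗_ = λ a x → γ (a ∗ proj₁ x) , idem _
    }
    where open Module M
          open StructuralNucleus N

  _⊢[_]_ : ∀ {c ℓ} {M : Module c ℓ} → Module.Carrier M → StructuralNucleus M
           → Module.Carrier M → Set ℓ
  _⊢[_]_ {M = M} x N y = Module._≤_ M y (StructuralNucleus.γ N x)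

  module _ {c₁ ℓ₁ c₂ ℓ₂} {P : Module c₁ ℓ₁} {Q : Module c₂ ℓ₂}
           (γ : StructuralNucleus P) (δ : StructuralNucleus Q)
           (τ : Hom (Module.ops P) (Module.ops Q)) (ρ : Hom (Module.ops Q) (Module.ops P)) where
    private
      t = Hom.fun τ
      r = Hom.fun ρ

    Cond1 : Set (c₁ ⊔ ℓ₁ ⊔ c₂ ⊔ ℓ₂)
    Cond1 = (∀ Γ Δ → (Γ ⊢[ γ ] Δ) ⇔ (t Γ ⊢[ δ ] t Δ))
          × (∀ E → (E ⊢[ δ ] t (r E)) × (t (r E) ⊢[ δ ] E))

    Cond2 : Set (c₁ ⊔ ℓ₁ ⊔ c₂ ⊔ ℓ₂)
    Cond2 = (∀ E F → (E ⊢[ δ ] F) ⇔ (r E ⊢[ γ ] r F))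
          × (∀ Γ → (Γ ⊢[ γ ] r (t Γ)) × (r (t Γ) ⊢[ γ ] Γ))

-- Since x ⊢γ y iff γ y ≤ γ x, the nucleus γ is determined by ⊢γ, and P_γ is the quotient of P
-- along the surjective homomorphism x ↦ γ x. Homomorphisms τ, ρ as in (1) and (2) preserve
-- consequence, so they descend to maps x ↦ δ (τ x) and y ↦ γ (ρ y) between the quotients, which
-- are mutually inverse because ρ ∘ τ and τ ∘ ρ are inter-derivable with the identity. Conversely,
-- by projectivity an isomorphism P_γ ≅ Q_δ and its inverse lift along the quotient maps to τ and
-- ρ, and (1) holds because an isomorphism is an order embedding. Finally, (2) is (1) with the two
-- sides exchanged, and (1) implies (2) since δ (τ (ρ E)) = δ E lets ⊢δ be tested after τ ∘ ρ.
module Submission where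

open import Defs
open import Level using (Level; Lift; lift)
open import Data.Bool using (Bool; true; false)
open import Data.Unit.Polymorphic using (tt)
open import Data.Product using (Σ; _×_; _,_; proj₁; proj₂)
open import Data.Product.Properties using (Σ-≡,≡→≡)
open import Axiom.UniquenessOfIdentityProofs.WithK using (uip)
open import Function.Base using (_∘_)
open import Function.Bundles using (_⇔_; mk⇔; Equivalence)
open import Function.Construct.Symmetry using (⇔-sym)
open import Function.Related.Propositional using (module EquationalReasoning)
open import Relation.Binary.PropositionalEquality
  using (_≡_; refl; sym; trans; cong; cong₂; subst; subst₂; isEquivalence; module ≡-Reasoning)
open import Relation.Binary.Structures using (IsPartialOrder)
open import Algebra.Structures using (IsMonoid)

fixed-point-≡ : ∀ {a} {A : Set a} {f : A → A} {x y : Σ A (λ z → f z ≡ z)}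
                → proj₁ x ≡ proj₁ y → x ≡ y
fixed-point-≡ p = Σ-≡,≡→≡ (p , uip _ _)

two-allowed : ∀ s {ι} → Allowed s (Lift ι Bool)
two-allowed plain       = tt
two-allowed generalized = lift true

module _ {s ι c₁ ℓ₁ c₂ ℓ₂} {M : QuantaleOps s ι c₁ ℓ₁} {N : QuantaleOps s ι c₂ ℓ₂}
         (M-isQuantale : IsQuantale M) (N-isQuantale : IsQuantale N) where
  private
    module M = QuantaleOps M
    module N = QuantaleOps N
    module MQ = IsQuantale M-isQuantale
    module NQ = IsQuantale N-isQuantale
    module M≤ = IsPartialOrder MQ.isPartialOrder

  -- If x ≤ y then y is the join of the two-element family {x, y}, so f y is an upper bound of f x.
  ⋁-preserving⇒monotone : (f : M.Carrier → N.Carrier)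
    → (∀ {I : Set ι} (x : I → M.Carrier) (w : Allowed s I) → f (M.⋁ x w) ≡ N.⋁ (f ∘ x) w)
    → ∀ {x y} → x M.≤ y → f x N.≤ f y
  ⋁-preserving⇒monotone f pres-⋁ {x} {y} x≤y =
    subst (f x N.≤_) (trans (sym (pres-⋁ pair w)) (cong f pair-join))
      (proj₁ (NQ.⋁-isJoin (f ∘ pair) w) (lift true))
    where
      w = two-allowed s
      pair : Lift ι Bool → M.Carrier
      pair (lift true)  = x
      pair (lift false) = y
      pair≤y : ∀ i → pair i M.≤ y
      pair≤y (lift true)  = x≤y
      pair≤y (lift false) = M≤.refl
      pair-join : M.⋁ pair w ≡ y
      pair-join = M≤.antisym (proj₂ (MQ.⋁-isJoin pair w) y pair≤y)
                             (proj₁ (MQ.⋁-isJoin pair w) (lift false))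

module _ {s ι d a aℓ} (𝔸 : AQM s ι d a aℓ) where
  private
    module 𝔸 = AQM 𝔸
    A-refl : ∀ {b} → QuantaleOps._≤_ 𝔸.A b b
    A-refl = IsPartialOrder.refl (IsQuantale.isPartialOrder 𝔸.A-isQuantale)

  module NucleusProperties {c ℓ} {M : Module 𝔸 c ℓ} (N : StructuralNucleus 𝔸 M) where
    open Module M
    open IsModule isModule
    open IsQuantale Q-isQuantale
    open StructuralNucleus N public
    private
      module ≤ = IsPartialOrder isPartialOrder
      module + = IsMonoid +-isMonoid

    infix 4 _⊢_
    _⊢_ : Carrier → Carrier → Set ℓ
    x ⊢ y = _⊢[_]_ 𝔸 x N y

    ≤γ⇒γ≤γ : ∀ {x y} → x ≤ γ y → γ x ≤ γ y
    ≤γ⇒γ≤γ x≤γy = ≤.trans (mono x≤γy) (≤.reflexive (idem _))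

    ⊢⇔γ≤γ : ∀ {x y} → x ⊢ y ⇔ γ y ≤ γ x
    ⊢⇔γ≤γ {x} {y} = mk⇔ ≤γ⇒γ≤γ (≤.trans (expansive y))

    γ≡γ⇒⊢ : ∀ {x y} → γ x ≡ γ y → x ⊢ y
    γ≡γ⇒⊢ {y = y} γx≡γy = ≤.trans (expansive y) (≤.reflexive (sym γx≡γy))

    ⊢-antisym : ∀ {x y} → x ⊢ y → y ⊢ x → γ x ≡ γ y
    ⊢-antisym x⊢y y⊢x = ≤.antisym (≤γ⇒γ≤γ y⊢x) (≤γ⇒γ≤γ x⊢y)

    ⊢-resp-γ : ∀ {x x′ y y′} → γ x ≡ γ x′ → γ y ≡ γ y′ → x ⊢ y ⇔ x′ ⊢ y′
    ⊢-resp-γ {x} {x′} {y} {y′} γx≡γx′ γy≡γy′ = begin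
      x ⊢ y          ∼⟨ ⊢⇔γ≤γ ⟩
      γ y ≤ γ x      ≡⟨ cong₂ _≤_ γy≡γy′ γx≡γx′ ⟩
      γ y′ ≤ γ x′    ∼⟨ ⇔-sym ⊢⇔γ≤γ ⟩
      x′ ⊢ y′        ∎
      where open EquationalReasoning

    γ-absorbs-⋁ : ∀ {I : Set ι} (x : I → Carrier) (w : Allowed s I) → γ (⋁ (γ ∘ x) w) ≡ γ (⋁ x w)
    γ-absorbs-⋁ x w = ≤.antisym
      (≤γ⇒γ≤γ (proj₂ (⋁-isJoin (γ ∘ x) w) _ (λ i → mono (proj₁ (⋁-isJoin x w) i))))
      (mono (proj₂ (⋁-isJoin x w) _ (λ i → ≤.trans (expansive (x i)) (proj₁ (⋁-isJoin (γ ∘ x) w) i))))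

    γ-absorbsˡ-+ : ∀ x y → γ (γ x + y) ≡ γ (x + y)
    γ-absorbsˡ-+ x y = ≤.antisym
      (≤γ⇒γ≤γ (≤.trans (+-mono ≤.refl (expansive y)) (+-sub x y)))
      (mono (+-mono (expansive x) ≤.refl))

    γ-absorbsʳ-+ : ∀ x y → γ (x + γ y) ≡ γ (x + y)
    γ-absorbsʳ-+ x y = ≤.antisym
      (≤γ⇒γ≤γ (≤.trans (+-mono (expansive x) ≤.refl) (+-sub x y)))
      (mono (+-mono ≤.refl (expansive y)))

    γ-absorbs-+ : ∀ x y → γ (γ x + γ y) ≡ γ (x + y)
    γ-absorbs-+ x y = trans (γ-absorbsˡ-+ x (γ y)) (γ-absorbsʳ-+ x y)

    γ-absorbs-∗ : ∀ b x → γ (b ∗ γ x) ≡ γ (b ∗ x)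
    γ-absorbs-∗ b x = ≤.antisym (≤γ⇒γ≤γ (∗-sub b x))
      (mono (∗-mono A-refl (expansive x)))

    Fix : Set c
    Fix = Σ Carrier (λ x → γ x ≡ x)

    fix : Carrier → Fix
    fix x = γ x , idem x

    quotient-isQuantale : IsQuantale (ModuleOps.Q (_/_ 𝔸 M N))
    quotient-isQuantale = record
      { isPartialOrder = record
          { isPreorder = record
              { isEquivalence = isEquivalence
              ; reflexive     = λ { refl → ≤.refl }
              ; trans         = ≤.trans
              }
          ; antisym = λ p q → fixed-point-≡ (≤.antisym p q)
          }
      ; ⋁-isJoin = λ x w →
            (λ i → ≤.trans (proj₁ (⋁-isJoin _ w) i) (expansive _))
          , (λ u x≤u → ≤.trans (mono (proj₂ (⋁-isJoin _ w) _ x≤u)) (≤.reflexive (proj₂ u)))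
      ; +-isMonoid = record
          { isSemigroup = record
              { isMagma = record { isEquivalence = isEquivalence
                                 ; ∙-cong = cong₂ _ }
              ; assoc   = λ x y z → fixed-point-≡ (γ-+-assoc (proj₁ x) (proj₁ y) (proj₁ z))
              }
          ; identity = (λ x → fixed-point-≡ (trans (γ-absorbsˡ-+ 𝟘 (proj₁ x))
                                                  (trans (cong γ (proj₁ +.identity _)) (proj₂ x))))
                     , (λ x → fixed-point-≡ (trans (γ-absorbsʳ-+ (proj₁ x) 𝟘)
                                                  (trans (cong γ (proj₂ +.identity _)) (proj₂ x))))
          }
      ; +-mono       = λ p q → mono (+-mono p q)
      ; +-distribʳ-⋁ = λ x w b → fixed-point-≡ (begin
          γ (γ (⋁ (proj₁ ∘ x) w) + proj₁ b)      ≡⟨ γ-absorbsˡ-+ _ _ ⟩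
          γ (⋁ (proj₁ ∘ x) w + proj₁ b)          ≡⟨ cong γ (+-distribʳ-⋁ _ w _) ⟩
          γ (⋁ (λ i → proj₁ (x i) + proj₁ b) w)  ≡⟨ γ-absorbs-⋁ _ w ⟨
          γ (⋁ (λ i → γ (proj₁ (x i) + proj₁ b)) w) ∎)
      ; +-distribˡ-⋁ = λ x w b → fixed-point-≡ (begin
          γ (proj₁ b + γ (⋁ (proj₁ ∘ x) w))      ≡⟨ γ-absorbsʳ-+ _ _ ⟩
          γ (proj₁ b + ⋁ (proj₁ ∘ x) w)          ≡⟨ cong γ (+-distribˡ-⋁ _ w _) ⟩
          γ (⋁ (λ i → proj₁ b + proj₁ (x i)) w)  ≡⟨ γ-absorbs-⋁ _ w ⟨
          γ (⋁ (λ i → γ (proj₁ b + proj₁ (x i))) w) ∎)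
      }
      where
        open ≡-Reasoning
        γ-+-assoc : ∀ x y z → γ (γ (x + y) + z) ≡ γ (x + γ (y + z))
        γ-+-assoc x y z = begin
          γ (γ (x + y) + z)  ≡⟨ γ-absorbsˡ-+ _ z ⟩
          γ ((x + y) + z)    ≡⟨ cong γ (+.assoc x y z) ⟩
          γ (x + (y + z))    ≡⟨ γ-absorbsʳ-+ x _ ⟨
          γ (x + γ (y + z))  ∎

    quotient : Module 𝔸 c ℓ
    quotient = record
      { ops      = _/_ 𝔸 M N
      ; isModule = record
          { Q-isQuantale = quotient-isQuantale
          ; ∗-mono       = λ p q → mono (∗-mono p q)
          ; ∗-assoc      = λ b b′ x → fixed-point-≡
              (trans (cong γ (∗-assoc b b′ _)) (sym (γ-absorbs-∗ b _)))
          ; ∗-identity   = λ x → fixed-point-≡ (trans (cong γ (∗-identity _)) (proj₂ x))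
          ; ∗-distrib-+  = λ b b′ x → fixed-point-≡
              (trans (cong γ (∗-distrib-+ b b′ _)) (sym (γ-absorbs-+ _ _)))
          ; ∗-zero       = λ x → fixed-point-≡ (cong γ (∗-zero _))
          ; ∗-distrib-⋁  = λ bs w x → fixed-point-≡
              (trans (cong γ (∗-distrib-⋁ bs w _)) (sym (γ-absorbs-⋁ _ w)))
          ; inj-∗-+      = λ e x y → fixed-point-≡
              (trans (γ-absorbs-∗ _ _) (trans (cong γ (inj-∗-+ e _ _)) (sym (γ-absorbs-+ _ _))))
          ; inj-∗-𝟘      = λ e → fixed-point-≡ (trans (γ-absorbs-∗ _ _) (cong γ (inj-∗-𝟘 e)))
          ; inj-∗-⋁      = λ e x w → fixed-point-≡
              (trans (γ-absorbs-∗ _ _) (trans (cong γ (inj-∗-⋁ e _ w)) (sym (γ-absorbs-⋁ _ w))))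
          }
      }

    π : Hom 𝔸 ops (_/_ 𝔸 M N)
    π = record
      { fun    = fix
      ; pres-⋁ = λ x w → fixed-point-≡ (sym (γ-absorbs-⋁ x w))
      ; pres-+ = λ x y → fixed-point-≡ (sym (γ-absorbs-+ x y))
      ; pres-𝟘 = refl
      ; pres-∗ = λ b x → fixed-point-≡ (sym (γ-absorbs-∗ b x))
      }

    π-surjective : ∀ y → Σ Carrier (λ x → fix x ≡ y)
    π-surjective y = proj₁ y , fixed-point-≡ (proj₂ y)

  infixr 9 _∘ᴴ_
  _∘ᴴ_ : ∀ {c₁ ℓ₁ c₂ ℓ₂ c₃ ℓ₃} {L : ModuleOps 𝔸 c₁ ℓ₁} {M : ModuleOps 𝔸 c₂ ℓ₂} {N : ModuleOps 𝔸 c₃ ℓ₃}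
         → Hom 𝔸 M N → Hom 𝔸 L M → Hom 𝔸 L N
  g ∘ᴴ f = record
    { fun    = G.fun ∘ F.fun
    ; pres-⋁ = λ x w → trans (cong G.fun (F.pres-⋁ x w)) (G.pres-⋁ _ w)
    ; pres-+ = λ x y → trans (cong G.fun (F.pres-+ x y)) (G.pres-+ _ _)
    ; pres-𝟘 = trans (cong G.fun F.pres-𝟘) G.pres-𝟘
    ; pres-∗ = λ b x → trans (cong G.fun (F.pres-∗ b x)) (G.pres-∗ _ _)
    }
    where
      module G = Hom g
      module F = Hom f

  Hom-monotone : ∀ {c₁ ℓ₁ c₂ ℓ₂} (M : Module 𝔸 c₁ ℓ₁) (N : Module 𝔸 c₂ ℓ₂)
                 (f : Hom 𝔸 (Module.ops M) (Module.ops N))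
                 → ∀ {x y} → Module._≤_ M x y → Module._≤_ N (Hom.fun f x) (Hom.fun f y)
  Hom-monotone M N f = ⋁-preserving⇒monotone
    (IsModule.Q-isQuantale (Module.isModule M)) (IsModule.Q-isQuantale (Module.isModule N))
    (Hom.fun f) (Hom.pres-⋁ f)

  Iso-≤⇔ : ∀ {c₁ ℓ₁ c₂ ℓ₂} (M : Module 𝔸 c₁ ℓ₁) (N : Module 𝔸 c₂ ℓ₂)
           (I : Iso 𝔸 (Module.ops M) (Module.ops N))
           → ∀ {x y} → Module._≤_ M x y ⇔ Module._≤_ N (Hom.fun (Iso.to I) x) (Hom.fun (Iso.to I) y)
  Iso-≤⇔ M N I {x} {y} = mk⇔ (Hom-monotone M N (Iso.to I))
    (subst₂ (Module._≤_ M) (Iso.from∘to I x) (Iso.from∘to I y) ∘ Hom-monotone N M (Iso.from I))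

  module _ {c₁ ℓ₁ c₂ ℓ₂} {P : Module 𝔸 c₁ ℓ₁} {Q : Module 𝔸 c₂ ℓ₂}
           (γ : StructuralNucleus 𝔸 P) (δ : StructuralNucleus 𝔸 Q) where
    private
      module γ = NucleusProperties γ
      module δ = NucleusProperties δ

    ⊢-preserving⇒δτγ≡δτ : (τ : Module.Carrier P → Module.Carrier Q)
      → (∀ {Γ Δ} → Γ γ.⊢ Δ → τ Γ δ.⊢ τ Δ) → ∀ Γ → δ.γ (τ (γ.γ Γ)) ≡ δ.γ (τ Γ)
    ⊢-preserving⇒δτγ≡δτ τ pres Γ =
      sym (δ.⊢-antisym (pres (γ.γ≡γ⇒⊢ (sym (γ.idem Γ)))) (pres (γ.γ≡γ⇒⊢ (γ.idem Γ))))

    induced : (τ : Hom 𝔸 (Module.ops P) (Module.ops Q))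
      → (∀ {Γ Δ} → Γ γ.⊢ Δ → Hom.fun τ Γ δ.⊢ Hom.fun τ Δ) → Hom 𝔸 (_/_ 𝔸 P γ) (_/_ 𝔸 Q δ)
    induced τ pres = record
      { fun    = δ.fix ∘ t ∘ proj₁
      ; pres-⋁ = λ x w → fixed-point-≡ (begin
          δ.γ (t (γ.γ (P.⋁ (proj₁ ∘ x) w)))  ≡⟨ δτγ≡δτ _ ⟩
          δ.γ (t (P.⋁ (proj₁ ∘ x) w))        ≡⟨ cong δ.γ (Hom.pres-⋁ τ _ w) ⟩
          δ.γ (Q.⋁ (t ∘ proj₁ ∘ x) w)        ≡⟨ δ.γ-absorbs-⋁ _ w ⟨
          δ.γ (Q.⋁ (δ.γ ∘ t ∘ proj₁ ∘ x) w)  ∎)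
      ; pres-+ = λ x y → fixed-point-≡ (begin
          δ.γ (t (γ.γ (proj₁ x P.+ proj₁ y)))   ≡⟨ δτγ≡δτ _ ⟩
          δ.γ (t (proj₁ x P.+ proj₁ y))         ≡⟨ cong δ.γ (Hom.pres-+ τ _ _) ⟩
          δ.γ (t (proj₁ x) Q.+ t (proj₁ y))     ≡⟨ δ.γ-absorbs-+ _ _ ⟨
          δ.γ (δ.γ (t (proj₁ x)) Q.+ δ.γ (t (proj₁ y))) ∎)
      ; pres-𝟘 = fixed-point-≡ (trans (δτγ≡δτ _) (cong δ.γ (Hom.pres-𝟘 τ)))
      ; pres-∗ = λ b x → fixed-point-≡ (begin
          δ.γ (t (γ.γ (b P.∗ proj₁ x)))  ≡⟨ δτγ≡δτ _ ⟩
          δ.γ (t (b P.∗ proj₁ x))        ≡⟨ cong δ.γ (Hom.pres-∗ τ _ _) ⟩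
          δ.γ (b Q.∗ t (proj₁ x))        ≡⟨ δ.γ-absorbs-∗ _ _ ⟨
          δ.γ (b Q.∗ δ.γ (t (proj₁ x)))  ∎)
      }
      where
        open ≡-Reasoning
        module P = Module P
        module Q = Module Q
        t = Hom.fun τ
        δτγ≡δτ : ∀ Γ → δ.γ (t (γ.γ Γ)) ≡ δ.γ (t Γ)
        δτγ≡δτ = ⊢-preserving⇒δτγ≡δτ t pres

    lift-along-π : ProjectiveAt 𝔸 c₂ ℓ₂ P → (h : Hom 𝔸 (Module.ops P) (_/_ 𝔸 Q δ))
      → Σ (Hom 𝔸 (Module.ops P) (Module.ops Q)) (λ τ → ∀ Γ → δ.fix (Hom.fun τ Γ) ≡ Hom.fun h Γ)
    lift-along-π projP = projP Q δ.quotient δ.π δ.π-surjective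

    module _ (τ : Hom 𝔸 (Module.ops P) (Module.ops Q)) (ρ : Hom 𝔸 (Module.ops Q) (Module.ops P)) where
      private
        t = Hom.fun τ
        r = Hom.fun ρ

      Cond1⇒δτρ≡δ : Cond1 𝔸 γ δ τ ρ → ∀ E → δ.γ (t (r E)) ≡ δ.γ E
      Cond1⇒δτρ≡δ (_ , E⊣⊢τρE) E = sym (δ.⊢-antisym (proj₁ (E⊣⊢τρE E)) (proj₂ (E⊣⊢τρE E)))

      Cond1⇒Cond2 : Cond1 𝔸 γ δ τ ρ → Cond2 𝔸 γ δ τ ρ
      Cond1⇒Cond2 c1@(τ-⊢ , E⊣⊢τρE) = ρ-⊢ , Γ⊣⊢ρτΓ
        where
          δτρ≡δ : ∀ E → δ.γ (t (r E)) ≡ δ.γ E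
          δτρ≡δ = Cond1⇒δτρ≡δ c1
          ρ-⊢ : ∀ E F → E δ.⊢ F ⇔ r E γ.⊢ r F
          ρ-⊢ E F = begin
            E δ.⊢ F              ∼⟨ δ.⊢-resp-γ (sym (δτρ≡δ E)) (sym (δτρ≡δ F)) ⟩
            t (r E) δ.⊢ t (r F)  ∼⟨ ⇔-sym (τ-⊢ (r E) (r F)) ⟩
            r E γ.⊢ r F          ∎
            where open EquationalReasoning
          Γ⊣⊢ρτΓ : ∀ Γ → (Γ γ.⊢ r (t Γ)) × (r (t Γ) γ.⊢ Γ)
          Γ⊣⊢ρτΓ Γ = Equivalence.from (τ-⊢ Γ _) (proj₁ (E⊣⊢τρE (t Γ)))
                   , Equivalence.from (τ-⊢ _ Γ) (proj₂ (E⊣⊢τρE (t Γ)))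

  module _ {c₁ ℓ₁ c₂ ℓ₂} {P : Module 𝔸 c₁ ℓ₁} {Q : Module 𝔸 c₂ ℓ₂}
           (γ : StructuralNucleus 𝔸 P) (δ : StructuralNucleus 𝔸 Q) where
    private
      module γ = NucleusProperties γ
      module δ = NucleusProperties δ

    conditions⇒Iso : (τ : Hom 𝔸 (Module.ops P) (Module.ops Q)) (ρ : Hom 𝔸 (Module.ops Q) (Module.ops P))
      → Cond1 𝔸 γ δ τ ρ → Cond2 𝔸 γ δ τ ρ → Iso 𝔸 (_/_ 𝔸 P γ) (_/_ 𝔸 Q δ)
    conditions⇒Iso τ ρ c1 c2 = record
      { to      = induced γ δ τ τ-pres
      ; from    = induced δ γ ρ ρ-pres
      ; from∘to = λ x → fixed-point-≡ (begin
          γ.γ (r (δ.γ (t (proj₁ x))))  ≡⟨ ⊢-preserving⇒δτγ≡δτ δ γ r ρ-pres _ ⟩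
          γ.γ (r (t (proj₁ x)))        ≡⟨ Cond1⇒δτρ≡δ δ γ ρ τ c2 _ ⟩
          γ.γ (proj₁ x)                ≡⟨ proj₂ x ⟩
          proj₁ x                      ∎)
      ; to∘from = λ y → fixed-point-≡ (begin
          δ.γ (t (γ.γ (r (proj₁ y))))  ≡⟨ ⊢-preserving⇒δτγ≡δτ γ δ t τ-pres _ ⟩
          δ.γ (t (r (proj₁ y)))        ≡⟨ Cond1⇒δτρ≡δ γ δ τ ρ c1 _ ⟩
          δ.γ (proj₁ y)                ≡⟨ proj₂ y ⟩
          proj₁ y                      ∎)
      }
      where
        open ≡-Reasoning
        t = Hom.fun τ
        r = Hom.fun ρ
        τ-pres : ∀ {Γ Δ} → Γ γ.⊢ Δ → t Γ δ.⊢ t Δ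
        τ-pres {Γ} {Δ} = Equivalence.to (proj₁ c1 Γ Δ)
        ρ-pres : ∀ {E F} → E δ.⊢ F → r E γ.⊢ r F
        ρ-pres {E} {F} = Equivalence.to (proj₁ c2 E F)

    Iso⇒Cond1 : ProjectiveAt 𝔸 c₂ ℓ₂ P → ProjectiveAt 𝔸 c₁ ℓ₁ Q → Iso 𝔸 (_/_ 𝔸 P γ) (_/_ 𝔸 Q δ)
      → Σ (Hom 𝔸 (Module.ops P) (Module.ops Q)) (λ τ →
          Σ (Hom 𝔸 (Module.ops Q) (Module.ops P)) (λ ρ → Cond1 𝔸 γ δ τ ρ))
    Iso⇒Cond1 projP projQ I = τ , ρ , τ-⊢ , E⊣⊢τρE
      where
        module Q = Module Q
        T = Hom.fun (Iso.to I)
        τ-lift : Σ (Hom 𝔸 (Module.ops P) (Module.ops Q)) (λ τ → ∀ Γ → δ.fix (Hom.fun τ Γ) ≡ T (γ.fix Γ))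
        τ-lift = lift-along-π γ δ projP (Iso.to I ∘ᴴ γ.π)
        ρ-lift : Σ (Hom 𝔸 (Module.ops Q) (Module.ops P))
                   (λ ρ → ∀ E → γ.fix (Hom.fun ρ E) ≡ Hom.fun (Iso.from I) (δ.fix E))
        ρ-lift = lift-along-π δ γ projQ (Iso.from I ∘ᴴ δ.π)
        τ : Hom 𝔸 (Module.ops P) (Module.ops Q)
        τ = proj₁ τ-lift
        ρ : Hom 𝔸 (Module.ops Q) (Module.ops P)
        ρ = proj₁ ρ-lift
        t = Hom.fun τ
        r = Hom.fun ρ

        δτ≡Tγ : ∀ Γ → δ.γ (t Γ) ≡ proj₁ (T (γ.fix Γ))
        δτ≡Tγ Γ = cong proj₁ (proj₂ τ-lift Γ)

        τ-⊢ : ∀ Γ Δ → Γ γ.⊢ Δ ⇔ t Γ δ.⊢ t Δ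
        τ-⊢ Γ Δ = begin
          Γ γ.⊢ Δ                                    ∼⟨ γ.⊢⇔γ≤γ ⟩
          Module._≤_ P (γ.γ Δ) (γ.γ Γ)               ∼⟨ Iso-≤⇔ γ.quotient δ.quotient I ⟩
          proj₁ (T (γ.fix Δ)) Q.≤ proj₁ (T (γ.fix Γ)) ≡⟨ cong₂ Q._≤_ (δτ≡Tγ Δ) (δτ≡Tγ Γ) ⟨
          δ.γ (t Δ) Q.≤ δ.γ (t Γ)                    ∼⟨ ⇔-sym δ.⊢⇔γ≤γ ⟩
          t Γ δ.⊢ t Δ                                ∎
          where open EquationalReasoning

        δτρ≡δ : ∀ E → δ.γ (t (r E)) ≡ δ.γ E
        δτρ≡δ E = cong proj₁ (begin
          δ.fix (t (r E))                 ≡⟨ proj₂ τ-lift (r E) ⟩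
          T (γ.fix (r E))                 ≡⟨ cong T (proj₂ ρ-lift E) ⟩
          T (Hom.fun (Iso.from I) (δ.fix E)) ≡⟨ Iso.to∘from I _ ⟩
          δ.fix E                         ∎)
          where open ≡-Reasoning

        E⊣⊢τρE : ∀ E → (E δ.⊢ t (r E)) × (t (r E) δ.⊢ E)
        E⊣⊢τρE E = δ.γ≡γ⇒⊢ (sym (δτρ≡δ E)) , δ.γ≡γ⇒⊢ (δτρ≡δ E)

-- Cond2 𝔸 γ δ τ ρ is definitionally Cond1 𝔸 δ γ ρ τ, and vice versa.
theorem7p3 : ∀ {s : Setting} {ι d a aℓ c₁ ℓ₁ c₂ ℓ₂ : Level} (𝔸 : AQM s ι d a aℓ)
    (P : Module 𝔸 c₁ ℓ₁) (Q : Module 𝔸 c₂ ℓ₂)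
    → Projective 𝔸 P → Projective 𝔸 Q
    → (γ : StructuralNucleus 𝔸 P) (δ : StructuralNucleus 𝔸 Q)
    → (Iso 𝔸 (_/_ 𝔸 P γ) (_/_ 𝔸 Q δ)
        ⇔ Σ (Hom 𝔸 (Module.ops P) (Module.ops Q)) (λ τ →
            Σ (Hom 𝔸 (Module.ops Q) (Module.ops P)) (λ ρ →
              Cond1 𝔸 γ δ τ ρ × Cond2 𝔸 γ δ τ ρ)))
      × (∀ (τ : Hom 𝔸 (Module.ops P) (Module.ops Q)) (ρ : Hom 𝔸 (Module.ops Q) (Module.ops P))
         → Cond1 𝔸 γ δ τ ρ ⇔ Cond2 𝔸 γ δ τ ρ)
theorem7p3 𝔸 P Q projP projQ γ δ =
    mk⇔ (λ I → let (τ , ρ , c1) = Iso⇒Cond1 𝔸 γ δ projP projQ I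
               in τ , ρ , c1 , Cond1⇒Cond2 𝔸 γ δ τ ρ c1)
        (λ { (τ , ρ , c1 , c2) → conditions⇒Iso 𝔸 γ δ τ ρ c1 c2 })
  , λ τ ρ → mk⇔ (Cond1⇒Cond2 𝔸 γ δ τ ρ) (Cond1⇒Cond2 𝔸 δ γ ρ τ)
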